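{- Let $0<c\le 1$ and let $M_n$ be a $c$-maximally ST-robust DAG with $n$ inputs and $n$ outputs. Then $\mathbb{O}(M_n)$ is maximally ST-robust, i.e. it is $(k,n-k)$-ST-robust for all $0\le k\le n$.
   Context: For a DAG $M$ with a set $I$ of $n$ inputs and a set $O$ of $n$ outputs, $M$ is $(k_1,k_2)$-ST-robust if for every $D\subseteq V(M)$ with $|D|\le k_1$ there is a subgraph $H$ of $M-D$ with $|I\cap V(H)|\ge k_2$, $|O\cap V(H)|\ge k_2$, such that every $s\in I\cap V(H)$ has a directed path in $H$ to every $t\in O\cap V(H)$. $M$ is $c$-maximally ST-robust if it is $(k,n-k)$-ST-robust for all $0\le k\le cn$. Construction $\mathbb{O}(M_n)$: take new input nodes $i_1,\dots,i_n$ and new output nodes $o_1,\dots,o_n$, and $\lceil 1/c\rceil$ disjoint copies $S_1,\dots,S_{\lceil 1/c\rceil}$ of $M_n$, where $S_j$ has inputs $i_1^j,\dots,i_n^j$ and outputs $o_1^j,\dots,o_n^j$. For every $1\le j\le\lceil 1/c\rceil$ and $1\le k\le n$ add edges $(i_k,i_k^j)$ and $(o_k^j,o_k)$. The inputs of $\mathbb{O}(M_n)$ are $i_1,\dots,i_n$ and its outputs are $o_1,\dots,o_n$.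
   Formalization: The constant c is taken to be rational, with $0<c\le 1$. -}

module Defs where

open import Data.Nat using (ℕ; zero; suc; _+_; _*_; _∸_; _≤_; _<_; NonZero)
open import Data.Nat.DivMod using (_/_)
open import Data.Bool using (Bool; true; false; T; _∧_)
open import Data.Fin using (Fin; splitAt; remQuot; combine; join; _≟_; _↑ˡ_; _↑ʳ_)
open import Data.Fin.Subset using (Subset; _∈_; _∉_; ∣_∣)
open import Data.Vec using (tabulate; lookup)
open import Data.Sum using (_⊎_; inj₁; inj₂)
open import Data.Product using (Σ; _×_; _,_)
open import Relation.Nullary using (¬_; does)
open import Relation.Binary.PropositionalEquality using (_≡_)
open import Data.Fin.Properties using (↑ˡ-injective; ↑ʳ-injective)
open import Function.Definitions using (Injective)

data Path {N : ℕ} (E : Fin N → Fin N → Set) : Fin N → Fin N → Set where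
  here : ∀ {v} → Path E v v
  step : ∀ {u v w} → E u v → Path E v w → Path E u w

data Path⁺ {N : ℕ} (E : Fin N → Fin N → Set) : Fin N → Fin N → Set where
  edge⁺ : ∀ {u v w} → E u v → Path E v w → Path⁺ E u w

Edge : {N : ℕ} → (Fin N → Fin N → Bool) → Fin N → Fin N → Set
Edge e u v = T (e u v)

record IOGraph (n : ℕ) : Set where
  field
    N       : ℕ
    edge    : Fin N → Fin N → Bool
    inp     : Fin n → Fin N
    out     : Fin n → Fin N
    inp-inj : Injective _≡_ _≡_ inp
    out-inj : Injective _≡_ _≡_ out

Acyclic : ∀ {n} → IOGraph n → Set
Acyclic G = ∀ v → ¬ Path⁺ (Edge (IOGraph.edge G)) v v

record DAG (n : ℕ) : Set where
  field
    graph   : IOGraph n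
    acyclic : Acyclic graph

#inputsIn : ∀ {n} (G : IOGraph n) → Subset (IOGraph.N G) → ℕ
#inputsIn G V = ∣ tabulate (λ k → lookup V (IOGraph.inp G k)) ∣

#outputsIn : ∀ {n} (G : IOGraph n) → Subset (IOGraph.N G) → ℕ
#outputsIn G V = ∣ tabulate (λ k → lookup V (IOGraph.out G k)) ∣

IsSubgraphMinus : ∀ {n} (G : IOGraph n) (D : Subset (IOGraph.N G))
  (VH : Subset (IOGraph.N G)) (EH : Fin (IOGraph.N G) → Fin (IOGraph.N G) → Set) → Set
IsSubgraphMinus G D VH EH =
  (∀ v → v ∈ VH → v ∉ D) ×
  (∀ u v → EH u v → Edge (IOGraph.edge G) u v × u ∈ VH × v ∈ VH)

STRobust : ∀ {n} → IOGraph n → ℕ → ℕ → Set₁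
STRobust {n} G k₁ k₂ =
  ∀ (D : Subset (IOGraph.N G)) → ∣ D ∣ ≤ k₁ →
  Σ (Subset (IOGraph.N G)) λ VH →
  Σ (Fin (IOGraph.N G) → Fin (IOGraph.N G) → Set) λ EH →
    IsSubgraphMinus G D VH EH ×
    k₂ ≤ #inputsIn G VH ×
    k₂ ≤ #outputsIn G VH ×
    (∀ (s t : Fin n) → IOGraph.inp G s ∈ VH → IOGraph.out G t ∈ VH →
       Path EH (IOGraph.inp G s) (IOGraph.out G t))

-- c-maximal ST-robustness for the rational c = p / q:
-- (k , n - k)-ST-robust for all k with k ≤ c n, i.e. k * q ≤ p * n.
MaxSTRobust[_/_] : (p q : ℕ) → ∀ {n} → IOGraph n → Set₁
MaxSTRobust[ p / q ] {n} G = ∀ k → k * q ≤ p * n → STRobust G k (n ∸ k)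

MaxSTRobust : ∀ {n} → IOGraph n → Set₁
MaxSTRobust {n} G = ∀ k → k ≤ n → STRobust G k (n ∸ k)

⌈_/_⌉ : ℕ → (p : ℕ) → .{{NonZero p}} → ℕ
⌈ q / p ⌉ = (q + p ∸ 1) / p

-- The construction 𝕆(M) with m copies.
-- Vertex layout: Fin (n + (n + m * N)): first the new inputs i_1..i_n,
-- then the new outputs o_1..o_n, then copy j of vertex v at combine j v.
data VKind (n m N : ℕ) : Set where
  newIn  : Fin n → VKind n m N
  newOut : Fin n → VKind n m N
  copy   : Fin m → Fin N → VKind n m N

kind : ∀ {n m N} → Fin (n + (n + m * N)) → VKind n m N
kind {n} {m} {N} x with splitAt n x
... | inj₁ k = newIn k
... | inj₂ y with splitAt n y
...   | inj₁ k = newOut k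
...   | inj₂ z with remQuot {m} N z
...     | j , v = copy j v

𝕆 : ∀ {n} (m : ℕ) → IOGraph n → IOGraph n
𝕆 {n} m G = record
  { N       = n + (n + m * N)
  ; edge    = λ x y → oEdge (kind {n} {m} {N} x) (kind {n} {m} {N} y)
  ; inp     = λ k → k ↑ˡ (n + m * N)
  ; out     = λ k → n ↑ʳ (k ↑ˡ (m * N))
  ; inp-inj = λ {x} {y} eq → ↑ˡ-injective (n + m * N) x y eq
  ; out-inj = λ {x} {y} eq → ↑ˡ-injective (m * N) x y (↑ʳ-injective n _ _ eq)
  }
  where
  open IOGraph G
  oEdge : VKind n m N → VKind n m N → Bool
  oEdge (newIn k)  (copy j v)  = does (v ≟ inp k)
  oEdge (copy j u) (copy j' v) = does (j ≟ j') ∧ edge u v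
  oEdge (copy j u) (newOut k)  = does (u ≟ out k)
  oEdge _          _           = false

-- Let D be a deleted set with ∣ D ∣ ≤ k ≤ n, and m = ⌈ q / p ⌉ the number of
-- copies. By averaging, some copy S_j meets D in d vertices with m d ≤ ∣ D ∣ ≤ n,
-- so d q ≤ d m p ≤ p n and the c-maximal robustness of M (c = p / q) yields a
-- witness H_j in S_j - D with n - d inputs and outputs pairwise connected.
-- Attach to H_j the new inputs i_k and outputs o_k that are not deleted and
-- whose copies i_k^j, o_k^j lie in H_j. If a new inputs are deleted, at least
-- n - d - a ≥ n - ∣ D ∣ ≥ n - k inputs survive, and likewise for outputs.
module Submission where

open import Defs
open import Data.Nat using (ℕ; zero; suc; _+_; _*_; _∸_; _≤_; _<_; NonZero; >-nonZero; >-nonZero⁻¹; z≤n; s≤s)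
open import Data.Nat.Properties using (≤-refl; ≤-trans; ≤-reflexive; _≤?_; ≰⇒>; <⇒≤; n≤1+n; m≤n+m; m≤n*m; +-suc; +-comm; *-comm; *-assoc; +-mono-≤; +-monoˡ-≤; +-monoʳ-≤; *-monoˡ-≤; *-monoʳ-≤; ∸-monoˡ-≤; ∸-monoʳ-≤; ∸-+-assoc; +-∸-assoc; +-cancelˡ-≤; m≤n+o⇒m∸n≤o; module ≤-Reasoning)
open import Data.Nat.DivMod using (_/_; _%_; m≡m%n+[m/n]*n; m%n<n; m≥n⇒m/n>0)
open import Data.Bool using (Bool; true; false; _∧_; not)
open import Data.Bool.Properties using (∧-conicalˡ; ∧-conicalʳ; not-¬; not-injective; ¬-not)
open import Data.Fin using (Fin; zero; suc; _↑ˡ_; _↑ʳ_; combine; _≟_)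
open import Data.Fin.Properties using (splitAt-↑ˡ; splitAt-↑ʳ; remQuot-combine)
open import Data.Fin.Subset using (Subset; _∈_; _∉_; ∣_∣)
open import Data.Vec using (tabulate; lookup; sum)
open import Data.Vec.Properties using (lookup∘tabulate; tabulate∘lookup; tabulate-cong; lookup⇒[]=; []=⇒lookup)
open import Data.Product using (Σ; ∃; _×_; _,_; proj₁; proj₂; uncurry)
open import Data.Unit using (tt)
open import Relation.Nullary using (yes; no; does)
open import Relation.Nullary.Decidable using (dec-true)
open import Relation.Binary.PropositionalEquality using (_≡_; refl; sym; trans; cong; module ≡-Reasoning)
open import Function using (_∘_)

private variable m n : ℕ

preimage : (Fin m → Fin n) → Subset n → Subset m
preimage f V = tabulate (lookup V ∘ f)

∈-tabulate⁺ : ∀ {f : Fin n → Bool} {x} → f x ≡ true → x ∈ tabulate f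
∈-tabulate⁺ {f = f} {x} fx = lookup⇒[]= x _ (trans (lookup∘tabulate f x) fx)

∈-tabulate⁻ : ∀ {f : Fin n → Bool} {x} → x ∈ tabulate f → f x ≡ true
∈-tabulate⁻ {f = f} {x} x∈ = trans (sym (lookup∘tabulate f x)) ([]=⇒lookup x∈)

∣tabulate∣-++ : ∀ a {b} (f : Fin (a + b) → Bool) →
  ∣ tabulate f ∣ ≡ ∣ tabulate (f ∘ (_↑ˡ b)) ∣ + ∣ tabulate (f ∘ (a ↑ʳ_)) ∣
∣tabulate∣-++ zero    f = refl
∣tabulate∣-++ (suc a) f with f zero
... | true  = cong suc (∣tabulate∣-++ a (f ∘ suc))
... | false = ∣tabulate∣-++ a (f ∘ suc)

∣tabulate∣-combine : ∀ m n (f : Fin (m * n) → Bool) →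
  ∣ tabulate f ∣ ≡ sum (tabulate λ j → ∣ tabulate (f ∘ combine {m} {n} j) ∣)
∣tabulate∣-combine zero    n f = refl
∣tabulate∣-combine (suc m) n f =
  trans (∣tabulate∣-++ n f)
        (cong (∣ tabulate (f ∘ (_↑ˡ (m * n))) ∣ +_) (∣tabulate∣-combine m n (f ∘ (n ↑ʳ_))))

∣f∣≤∣f∧¬g∣+∣g∣ : (f g : Fin n → Bool) →
  ∣ tabulate f ∣ ≤ ∣ tabulate (λ i → f i ∧ not (g i)) ∣ + ∣ tabulate g ∣
∣f∣≤∣f∧¬g∣+∣g∣ {zero}  f g = z≤n
∣f∣≤∣f∧¬g∣+∣g∣ {suc n} f g with f zero | g zero | ∣f∣≤∣f∧¬g∣+∣g∣ (f ∘ suc) (g ∘ suc)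
... | true  | true  | ih = ≤-trans (s≤s ih) (≤-reflexive (sym (+-suc _ _)))
... | true  | false | ih = s≤s ih
... | false | true  | ih = ≤-trans ih (+-monoʳ-≤ _ (n≤1+n _))
... | false | false | ih = ih

∣f∣∸∣g∣≤∣f∧¬g∣ : (f g : Fin n → Bool) →
  ∣ tabulate f ∣ ∸ ∣ tabulate g ∣ ≤ ∣ tabulate (λ i → f i ∧ not (g i)) ∣
∣f∣∸∣g∣≤∣f∧¬g∣ f g = m≤n+o⇒m∸n≤o ∣ tabulate f ∣ ∣ tabulate g ∣
  (≤-trans (∣f∣≤∣f∧¬g∣+∣g∣ f g) (≤-reflexive (+-comm ∣ tabulate (λ i → f i ∧ not (g i)) ∣ ∣ tabulate g ∣)))

∃-≤-average : .{{_ : NonZero m}} (F : Fin m → ℕ) → ∃ λ j → m * F j ≤ sum (tabulate F)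
∃-≤-average {suc zero}    F = zero , ≤-refl
∃-≤-average {suc (suc m)} F with ∃-≤-average (F ∘ suc)
... | j , mFj≤Σ with F zero ≤? F (suc j)
...   | yes F0≤Fj = zero , +-monoʳ-≤ (F zero) (≤-trans (*-monoʳ-≤ (suc m) F0≤Fj) mFj≤Σ)
...   | no  F0≰Fj = suc j , +-mono-≤ (<⇒≤ (≰⇒> F0≰Fj)) mFj≤Σ

0<⌈q/p⌉ : ∀ q p .{{_ : NonZero p}} → 0 < q → 0 < ⌈ q / p ⌉
0<⌈q/p⌉ (suc q) p _ = m≥n⇒m/n>0 (m≤n+m p q)

q≤⌈q/p⌉*p : ∀ q p .{{_ : NonZero p}} → q ≤ ⌈ q / p ⌉ * p
q≤⌈q/p⌉*p q p = +-cancelˡ-≤ (p ∸ 1) q (⌈ q / p ⌉ * p) (begin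
  p ∸ 1 + q                        ≡⟨ +-comm (p ∸ 1) q ⟩
  q + (p ∸ 1)                      ≡⟨ +-∸-assoc q (>-nonZero⁻¹ p) ⟨
  q + p ∸ 1                        ≡⟨ m≡m%n+[m/n]*n (q + p ∸ 1) p ⟩
  (q + p ∸ 1) % p + ⌈ q / p ⌉ * p  ≤⟨ +-monoˡ-≤ (⌈ q / p ⌉ * p) (∸-monoˡ-≤ 1 (m%n<n (q + p ∸ 1) p)) ⟩
  p ∸ 1 + ⌈ q / p ⌉ * p            ∎)
  where open ≤-Reasoning

-- STRobust G k₁ k₂ unfolds to  ∀ D → ∣ D ∣ ≤ k₁ → Witness G D k₂ k₂.
Witness : (G : IOGraph n) → Subset (IOGraph.N G) → ℕ → ℕ → Set₁
Witness {n} G D kᵢ kₒ =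
  Σ (Subset N) λ VH →
  Σ (Fin N → Fin N → Set) λ EH →
    IsSubgraphMinus G D VH EH ×
    kᵢ ≤ #inputsIn G VH ×
    kₒ ≤ #outputsIn G VH ×
    (∀ (s t : Fin n) → inp s ∈ VH → out t ∈ VH → Path EH (inp s) (out t))
  where open IOGraph G

Witness-mono : ∀ {G : IOGraph n} {D kᵢ kₒ kᵢ' kₒ'} → kᵢ' ≤ kᵢ → kₒ' ≤ kₒ →
  Witness G D kᵢ kₒ → Witness G D kᵢ' kₒ'
Witness-mono kᵢ'≤kᵢ kₒ'≤kₒ (VH , EH , sub , ins , outs , paths) =
  VH , EH , sub , ≤-trans kᵢ'≤kᵢ ins , ≤-trans kₒ'≤kₒ outs , paths

_++ᵖ_ : ∀ {N} {E : Fin N → Fin N → Set} {u v w} → Path E u v → Path E v w → Path E u w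
here     ++ᵖ q = q
step e p ++ᵖ q = step e (p ++ᵖ q)

Path-map : ∀ {N N'} {E : Fin N → Fin N → Set} {E' : Fin N' → Fin N' → Set} (f : Fin N → Fin N') →
  (∀ {u v} → E u v → E' (f u) (f v)) → ∀ {u v} → Path E u v → Path E' (f u) (f v)
Path-map f g here       = here
Path-map f g (step e p) = step (g e) (Path-map f g p)

module 𝕆-Properties {n : ℕ} (m : ℕ) (G : IOGraph n) where
  open IOGraph G
  open IOGraph (𝕆 m G) using ()
    renaming (N to Nᴼ; edge to edgeᴼ; inp to inpᴼ; out to outᴼ)

  copyᴼ : Fin m → Fin N → Fin Nᴼ
  copyᴼ j v = n ↑ʳ (n ↑ʳ combine j v)

  kind-inpᴼ : ∀ k → kind {n} {m} {N} (inpᴼ k) ≡ newIn k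
  kind-inpᴼ k rewrite splitAt-↑ˡ n k (n + m * N) = refl

  kind-outᴼ : ∀ k → kind {n} {m} {N} (outᴼ k) ≡ newOut k
  kind-outᴼ k rewrite splitAt-↑ʳ n (n + m * N) (k ↑ˡ (m * N))
                    | splitAt-↑ˡ n k (m * N) = refl

  kind-copyᴼ : ∀ j v → kind {n} {m} {N} (copyᴼ j v) ≡ copy j v
  kind-copyᴼ j v rewrite splitAt-↑ʳ n (n + m * N) (n ↑ʳ combine j v)
                       | splitAt-↑ʳ n (m * N) (combine j v)
                       = cong (uncurry copy) (remQuot-combine j v)

  edge-enter : ∀ j k → Edge edgeᴼ (inpᴼ k) (copyᴼ j (inp k))
  edge-enter j k rewrite kind-inpᴼ k | kind-copyᴼ j (inp k) | dec-true (inp k ≟ inp k) refl = tt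

  edge-within : ∀ j {u v} → Edge edge u v → Edge edgeᴼ (copyᴼ j u) (copyᴼ j v)
  edge-within j {u} {v} e rewrite kind-copyᴼ j u | kind-copyᴼ j v | dec-true (j ≟ j) refl = e

  edge-leave : ∀ j k → Edge edgeᴼ (copyᴼ j (out k)) (outᴼ k)
  edge-leave j k rewrite kind-outᴼ k | kind-copyᴼ j (out k) | dec-true (out k ≟ out k) refl = tt

  ∣D∣-decomposition : (D : Subset Nᴼ) →
    ∣ D ∣ ≡ ∣ preimage inpᴼ D ∣ + (∣ preimage outᴼ D ∣ + sum (tabulate λ j → ∣ preimage (copyᴼ j) D ∣))
  ∣D∣-decomposition D = begin
    ∣ D ∣                    ≡⟨ cong ∣_∣ (tabulate∘lookup D) ⟨
    ∣ tabulate (lookup D) ∣  ≡⟨ ∣tabulate∣-++ n (lookup D) ⟩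
    _                        ≡⟨ cong (∣ preimage inpᴼ D ∣ +_) (∣tabulate∣-++ n (lookup D ∘ (n ↑ʳ_))) ⟩
    _                        ≡⟨ cong (λ c → ∣ preimage inpᴼ D ∣ + (∣ preimage outᴼ D ∣ + c))
                                  (∣tabulate∣-combine m N (lookup D ∘ (n ↑ʳ_) ∘ (n ↑ʳ_))) ⟩
    _                        ∎
    where open ≡-Reasoning

  module Lift (D : Subset Nᴼ) (j : Fin m) (VHⱼ : Subset N) (EHⱼ : Fin N → Fin N → Set)
    (subⱼ : IsSubgraphMinus G (preimage (copyᴼ j) D) VHⱼ EHⱼ)
    (pathsⱼ : ∀ s t → inp s ∈ VHⱼ → out t ∈ VHⱼ → Path EHⱼ (inp s) (out t)) where

    kept : VKind n m N → Bool
    kept (newIn k)  = lookup VHⱼ (inp k)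
    kept (newOut k) = lookup VHⱼ (out k)
    kept (copy i v) = does (i ≟ j) ∧ lookup VHⱼ v

    VH : Subset Nᴼ
    VH = tabulate λ x → kept (kind x) ∧ not (lookup D x)

    data EH : Fin Nᴼ → Fin Nᴼ → Set where
      enter  : ∀ {k} → inpᴼ k ∈ VH → copyᴼ j (inp k) ∈ VH → EH (inpᴼ k) (copyᴼ j (inp k))
      within : ∀ {u v} → EHⱼ u v → EH (copyᴼ j u) (copyᴼ j v)
      leave  : ∀ {k} → copyᴼ j (out k) ∈ VH → outᴼ k ∈ VH → EH (copyᴼ j (out k)) (outᴼ k)

    lookup-VH : ∀ {x κ} → kind x ≡ κ → lookup VH x ≡ kept κ ∧ not (lookup D x)
    lookup-VH {x} refl = lookup∘tabulate _ x

    ∈VH⇒kept : ∀ {x κ} → kind x ≡ κ → x ∈ VH → kept κ ≡ true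
    ∈VH⇒kept refl x∈VH = ∧-conicalˡ _ _ (∈-tabulate⁻ x∈VH)

    ∈VH⇒∉D : ∀ x → x ∈ VH → x ∉ D
    ∈VH⇒∉D x x∈VH x∈D = not-¬ ([]=⇒lookup x∈D) (not-injective (∧-conicalʳ _ _ (∈-tabulate⁻ x∈VH)))

    copy∈VH : ∀ {v} → v ∈ VHⱼ → copyᴼ j v ∈ VH
    copy∈VH {v} v∈VHⱼ = ∈-tabulate⁺ kept∧¬D
      where
      kept∧¬D : kept (kind (copyᴼ j v)) ∧ not (lookup D (copyᴼ j v)) ≡ true
      kept∧¬D rewrite kind-copyᴼ j v | dec-true (j ≟ j) refl | []=⇒lookup v∈VHⱼ
                    | ¬-not (proj₁ subⱼ v v∈VHⱼ ∘ ∈-tabulate⁺) = refl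

    inpᴼ∈VH⇒inp∈VHⱼ : ∀ {k} → inpᴼ k ∈ VH → inp k ∈ VHⱼ
    inpᴼ∈VH⇒inp∈VHⱼ {k} h = lookup⇒[]= (inp k) VHⱼ (∈VH⇒kept (kind-inpᴼ k) h)

    outᴼ∈VH⇒out∈VHⱼ : ∀ {k} → outᴼ k ∈ VH → out k ∈ VHⱼ
    outᴼ∈VH⇒out∈VHⱼ {k} h = lookup⇒[]= (out k) VHⱼ (∈VH⇒kept (kind-outᴼ k) h)

    subgraph : IsSubgraphMinus (𝕆 m G) D VH EH
    subgraph = ∈VH⇒∉D , edges
      where
      edges : ∀ x y → EH x y → Edge edgeᴼ x y × x ∈ VH × y ∈ VH
      edges _ _ (enter {k} x∈ y∈) = edge-enter j k , x∈ , y∈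
      edges _ _ (within e) with proj₂ subⱼ _ _ e
      ... | uv , u∈ , v∈ = edge-within j uv , copy∈VH u∈ , copy∈VH v∈
      edges _ _ (leave {k} x∈ y∈) = edge-leave j k , x∈ , y∈

    paths : ∀ s t → inpᴼ s ∈ VH → outᴼ t ∈ VH → Path EH (inpᴼ s) (outᴼ t)
    paths s t s∈ t∈ =
      step (enter s∈ (copy∈VH s∈ⱼ))
        (Path-map (copyᴼ j) within (pathsⱼ s t s∈ⱼ t∈ⱼ) ++ᵖ step (leave (copy∈VH t∈ⱼ) t∈) here)
      where
      s∈ⱼ : inp s ∈ VHⱼ
      s∈ⱼ = inpᴼ∈VH⇒inp∈VHⱼ s∈
      t∈ⱼ : out t ∈ VHⱼ
      t∈ⱼ = outᴼ∈VH⇒out∈VHⱼ t∈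

    surviving-inputs : ∣ preimage inp VHⱼ ∣ ∸ ∣ preimage inpᴼ D ∣ ≤ #inputsIn (𝕆 m G) VH
    surviving-inputs = ≤-trans (∣f∣∸∣g∣≤∣f∧¬g∣ (lookup VHⱼ ∘ inp) (lookup D ∘ inpᴼ))
      (≤-reflexive (cong ∣_∣ (tabulate-cong λ k → sym (lookup-VH (kind-inpᴼ k)))))

    surviving-outputs : ∣ preimage out VHⱼ ∣ ∸ ∣ preimage outᴼ D ∣ ≤ #outputsIn (𝕆 m G) VH
    surviving-outputs = ≤-trans (∣f∣∸∣g∣≤∣f∧¬g∣ (lookup VHⱼ ∘ out) (lookup D ∘ outᴼ))
      (≤-reflexive (cong ∣_∣ (tabulate-cong λ k → sym (lookup-VH (kind-outᴼ k)))))

  lift : ∀ D j {kᵢ kₒ} → Witness G (preimage (copyᴼ j) D) kᵢ kₒ →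
    Witness (𝕆 m G) D (kᵢ ∸ ∣ preimage inpᴼ D ∣) (kₒ ∸ ∣ preimage outᴼ D ∣)
  lift D j (VHⱼ , EHⱼ , subⱼ , insⱼ , outsⱼ , pathsⱼ) =
    VH , EH , subgraph ,
    ≤-trans (∸-monoˡ-≤ ∣ preimage inpᴼ D ∣ insⱼ) surviving-inputs ,
    ≤-trans (∸-monoˡ-≤ ∣ preimage outᴼ D ∣ outsⱼ) surviving-outputs ,
    paths
    where open Lift D j VHⱼ EHⱼ subⱼ pathsⱼ

  maxSTRobust : ∀ {p q} .{{_ : NonZero m}} → q ≤ m * p →
    MaxSTRobust[ p / q ] G → MaxSTRobust (𝕆 m G)
  maxSTRobust {p} {q} q≤m*p robust k k≤n D ∣D∣≤k =
    Witness-mono {G = 𝕆 m G} (within-budget d+δᵢ≤k) (within-budget d+δₒ≤k)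
      (lift D j (robust d d*q≤p*n (preimage (copyᴼ j) D) ≤-refl))
    where
    δᵢ δₒ Σδ : ℕ
    δᵢ = ∣ preimage inpᴼ D ∣
    δₒ = ∣ preimage outᴼ D ∣
    δ : Fin m → ℕ
    δ i = ∣ preimage (copyᴼ i) D ∣
    Σδ = sum (tabulate δ)

    δᵢ+δₒ+Σδ≤k : δᵢ + (δₒ + Σδ) ≤ k
    δᵢ+δₒ+Σδ≤k = ≤-trans (≤-reflexive (sym (∣D∣-decomposition D))) ∣D∣≤k

    Σδ≤k : Σδ ≤ k
    Σδ≤k = ≤-trans (m≤n+m Σδ δₒ) (≤-trans (m≤n+m (δₒ + Σδ) δᵢ) δᵢ+δₒ+Σδ≤k)

    j : Fin m
    j = proj₁ (∃-≤-average δ)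
    d : ℕ
    d = δ j
    m*d≤Σδ : m * d ≤ Σδ
    m*d≤Σδ = proj₂ (∃-≤-average δ)

    d≤Σδ : d ≤ Σδ
    d≤Σδ = ≤-trans (m≤n*m d m) m*d≤Σδ

    d+δᵢ≤k : d + δᵢ ≤ k
    d+δᵢ≤k = ≤-trans (+-monoˡ-≤ δᵢ d≤Σδ)
      (≤-trans (≤-reflexive (+-comm Σδ δᵢ)) (≤-trans (+-monoʳ-≤ δᵢ (m≤n+m Σδ δₒ)) δᵢ+δₒ+Σδ≤k))

    d+δₒ≤k : d + δₒ ≤ k
    d+δₒ≤k = ≤-trans (+-monoˡ-≤ δₒ d≤Σδ)
      (≤-trans (≤-reflexive (+-comm Σδ δₒ)) (≤-trans (m≤n+m (δₒ + Σδ) δᵢ) δᵢ+δₒ+Σδ≤k))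

    within-budget : ∀ {x} → d + x ≤ k → n ∸ k ≤ n ∸ d ∸ x
    within-budget {x} d+x≤k = ≤-trans (∸-monoʳ-≤ n d+x≤k) (≤-reflexive (sym (∸-+-assoc n d x)))

    d*q≤p*n : d * q ≤ p * n
    d*q≤p*n = begin
      d * q        ≤⟨ *-monoʳ-≤ d q≤m*p ⟩
      d * (m * p)  ≡⟨ *-assoc d m p ⟨
      d * m * p    ≡⟨ cong (_* p) (*-comm d m) ⟩
      m * d * p    ≤⟨ *-monoˡ-≤ p (≤-trans m*d≤Σδ (≤-trans Σδ≤k k≤n)) ⟩
      n * p        ≡⟨ *-comm n p ⟩
      p * n        ∎
      where open ≤-Reasoning

theorem5 : (p q : ℕ) .{{_ : NonZero p}} → p ≤ q →
    ∀ {n} (M : DAG n) → MaxSTRobust[ p / q ] (DAG.graph M) →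
    MaxSTRobust (𝕆 ⌈ q / p ⌉ (DAG.graph M))
theorem5 p q p≤q M =
  𝕆-Properties.maxSTRobust ⌈ q / p ⌉ (DAG.graph M)
    {{>-nonZero (0<⌈q/p⌉ q p (≤-trans (>-nonZero⁻¹ p) p≤q))}} (q≤⌈q/p⌉*p q p)
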